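{- In the setting below, let $\rho$ be a stack configuration having a cycle $\mathcal{C}$ with vertices $v_0,\dots,v_{r-1}$. Then $v_0,\dots,v_{r-1}$ is also a cycle of $\Phi(\mathcal{C}\rho)$, and $\Phi(\mathcal{C}(\Phi(\mathcal{C}\rho)))=\rho$, where the inner $\mathcal{C}$ denotes pushing this cycle in $\Phi(\mathcal{C}\rho)$.
   Context: $G=(V,E)$ is a finite strongly connected directed graph, $T\subseteq V$ a nonempty set of targets, $V_0=V\setminus T$, $d(v)$ the out-degree. A stack configuration $\rho$ assigns to each $v\in V_0$ a bi-infinite sequence $\rho_v=(a^v_i)_{i\in\mathbb{Z}}$ of arcs leaving $v$ that is periodic with period $d(v)$ and such that $a^v_1,\dots,a^v_{d(v)}$ are the $d(v)$ distinct arcs leaving $v$ (pictured as $[\dots,a_{ -1},a_0\,|\,a_1,a_2,\dots]$); $a^v_0$ is the retrospective state (rotor) at $v$. Pushing the stack at $v$ replaces $(a_i)$ by $(a'_i)$ with $a'_i=a_{i-1}$. A cycle of $\rho$ is a sequence of distinct vertices $v_0,\dots,v_{r-1}\in V_0$ ($r\ge1$) such that $a^{v_j}_0$ is an arc from $v_j$ to $v_{j+1}$ (indices mod $r$); pushing the cycle gives $\mathcal{C}\rho$, obtained by pushing the stacks at $v_0,\dots,v_{r-1}$ and leaving the others unchanged. Flipping $\Phi$ replaces every stack $(a_i)$ by $(a'_i)$ with $a'_i=a_{1-i}$, i.e. $[\dots,a_0\,|\,a_1,\dots]\mapsto[\dots,a_2,a_1\,|\,a_0,a_{ -1},\dots]$.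 -}

module Defs where

open import Data.Nat using (ℕ; zero; suc)
open import Data.Nat.DivMod using (_%_; m%n<n)
open import Data.Fin using (Fin; toℕ; fromℕ<; _≟_)
open import Data.Fin.Properties using (any?)
open import Data.Fin.Subset using (Subset; _∈_; _∉_; Nonempty)
open import Data.List using (List; length; filter; allFin)
open import Data.Integer using (ℤ; +_; _+_; _-_; 1ℤ; 0ℤ)
open import Data.Product using (Σ; _×_; _,_; ∃)
open import Relation.Binary.PropositionalEquality using (_≡_)
open import Relation.Nullary using (¬_; does)
open import Function.Definitions using (Injective)
open import Data.Bool using (if_then_else_)

record Graph : Set where
  field
    n   : ℕ
    m   : ℕ
    src : Fin m → Fin n
    tgt : Fin m → Fin n
open Graph public

data Reach (G : Graph) : Fin (n G) → Fin (n G) → Set where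
  here : ∀ {u} → Reach G u u
  step : ∀ {u w} (a : Fin (m G)) → src G a ≡ u → Reach G (tgt G a) w → Reach G u w

StronglyConnected : Graph → Set
StronglyConnected G = ∀ u w → Reach G u w

outdeg : (G : Graph) → Fin (n G) → ℕ
outdeg G v = length (filter (λ a → src G a ≟ v) (allFin (m G)))

-- raw stack assignment: every vertex gets a bi-infinite sequence of arcs
-- (values at target vertices are irrelevant and never constrained)
Stacks : Graph → Set
Stacks G = Fin (n G) → ℤ → Fin (m G)

IsStackConfig : (G : Graph) → Subset (n G) → Stacks G → Set
IsStackConfig G T ρ = ∀ v → v ∉ T →
    (∀ i → ρ v (i + + outdeg G v) ≡ ρ v i)
  × (∀ (k : Fin (outdeg G v)) → src G (ρ v (+ suc (toℕ k))) ≡ v)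
  × Injective _≡_ _≡_ (λ (k : Fin (outdeg G v)) → ρ v (+ suc (toℕ k)))
  × (∀ a → src G a ≡ v → ∃ λ (k : Fin (outdeg G v)) → ρ v (+ suc (toℕ k)) ≡ a)

next : ∀ {k} → Fin (suc k) → Fin (suc k)
next {k} j = fromℕ< (m%n<n (suc (toℕ j)) (suc k))

-- v₀,…,v_{r-1} (r = suc k ≥ 1) is a cycle of ρ: distinct vertices of V₀
-- with rotor a₀ at v_j an arc from v_j to v_{j+1 mod r}.
IsCycle : (G : Graph) → Subset (n G) → Stacks G → ∀ {k} → (Fin (suc k) → Fin (n G)) → Set
IsCycle G T ρ cyc =
    Injective _≡_ _≡_ cyc
  × (∀ j → cyc j ∉ T)
  × (∀ j → src G (ρ (cyc j) 0ℤ) ≡ cyc j)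
  × (∀ j → tgt G (ρ (cyc j) 0ℤ) ≡ cyc (next j))

push : ∀ {A : Set} → (ℤ → A) → (ℤ → A)
push s i = s (i - 1ℤ)

pushCycle : (G : Graph) → ∀ {k} → (Fin (suc k) → Fin (n G)) → Stacks G → Stacks G
pushCycle G cyc ρ v =
  if does (any? (λ j → cyc j ≟ v)) then push (ρ v) else ρ v

flip : (G : Graph) → Stacks G → Stacks G
flip G ρ v i = ρ v (1ℤ - i)

-- At a single stack, pushing and then flipping is the reflection i ↦ −i, and
-- flipping alone is the reflection i ↦ 1 − i; both are involutions and both fix
-- the index-0 entry after a push.  Since Φ ∘ 𝒞 acts at each vertex by one of
-- them, it keeps the rotors along the cycle and squares to the identity.
module Submission where

open import Defs
open import Data.Nat using (suc)
open import Data.Fin using (Fin)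
open import Data.Fin.Subset using (Subset; _∉_; Nonempty)
open import Data.Fin.Properties using (any?)
open import Data.Integer using (ℤ; _-_; 1ℤ; 0ℤ)
open import Data.Integer.Tactic.RingSolver using (solve-∀)
open import Data.Bool using (Bool; true; false; if_then_else_)
open import Data.Product using (_×_; _,_)
open import Relation.Nullary using (does)
open import Relation.Nullary.Decidable using (dec-true)
open import Relation.Binary.PropositionalEquality using (_≡_; refl; sym; trans; cong; subst)
import Data.Fin as Fin

flipStack : ∀ {A : Set} → (ℤ → A) → (ℤ → A)
flipStack s i = s (1ℤ - i)

pushIf : ∀ {A : Set} → Bool → (ℤ → A) → (ℤ → A)
pushIf b s = if b then push s else s

flipStack-push-rotor : ∀ {A : Set} (s : ℤ → A) → flipStack (push s) 0ℤ ≡ s 0ℤ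
flipStack-push-rotor s = refl

reflect-push-involutive : ∀ i → 1ℤ - ((1ℤ - i) - 1ℤ) - 1ℤ ≡ i
reflect-push-involutive = solve-∀

reflect-involutive : ∀ i → 1ℤ - (1ℤ - i) ≡ i
reflect-involutive = solve-∀

flipStack-pushIf-involutive : ∀ {A : Set} b (s : ℤ → A) i →
  flipStack (pushIf b (flipStack (pushIf b s))) i ≡ s i
flipStack-pushIf-involutive true  s i = cong s (reflect-push-involutive i)
flipStack-pushIf-involutive false s i = cong s (reflect-involutive i)

-- flip G σ v and pushCycle G cyc σ v are definitionally flipStack (σ v) and
-- pushIf (onCycle v) (σ v); the proofs below rely on this.
module _ (G : Graph) {k} (cyc : Fin (suc k) → Fin (n G)) where

  onCycle : Fin (n G) → Bool
  onCycle v = does (any? (λ j → cyc j Fin.≟ v))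

  onCycle-cyc : ∀ j → onCycle (cyc j) ≡ true
  onCycle-cyc j = dec-true (any? (λ i → cyc i Fin.≟ cyc j)) (j , refl)

  pushCycle-cyc : ∀ (σ : Stacks G) j → pushCycle G cyc σ (cyc j) ≡ push (σ (cyc j))
  pushCycle-cyc σ j = cong (λ b → pushIf b (σ (cyc j))) (onCycle-cyc j)

  flip-pushCycle-rotor : ∀ (σ : Stacks G) j →
    flip G (pushCycle G cyc σ) (cyc j) 0ℤ ≡ σ (cyc j) 0ℤ
  flip-pushCycle-rotor σ j =
    trans (cong (λ s → flipStack s 0ℤ) (pushCycle-cyc σ j)) (flipStack-push-rotor (σ (cyc j)))

  IsCycle-cong-rotor : ∀ T (σ τ : Stacks G) → (∀ j → τ (cyc j) 0ℤ ≡ σ (cyc j) 0ℤ) →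
    IsCycle G T σ cyc → IsCycle G T τ cyc
  IsCycle-cong-rotor T σ τ same (inj , ∉T , srcs , tgts) =
    inj , ∉T ,
    (λ j → subst (λ a → src G a ≡ cyc j) (sym (same j)) (srcs j)) ,
    (λ j → subst (λ a → tgt G a ≡ cyc (next j)) (sym (same j)) (tgts j))

  flip-pushCycle-involutive : ∀ (σ : Stacks G) v i →
    flip G (pushCycle G cyc (flip G (pushCycle G cyc σ))) v i ≡ σ v i
  flip-pushCycle-involutive σ v = flipStack-pushIf-involutive (onCycle v) (σ v)

lemma4p1 : (G : Graph) → StronglyConnected G → (T : Subset (n G)) → Nonempty T →
    (ρ : Stacks G) → IsStackConfig G T ρ →
    ∀ {k} (cyc : Fin (suc k) → Fin (n G)) → IsCycle G T ρ cyc →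
    IsCycle G T (flip G (pushCycle G cyc ρ)) cyc
    × (∀ v → v ∉ T → ∀ (i : ℤ) →
         flip G (pushCycle G cyc (flip G (pushCycle G cyc ρ))) v i ≡ ρ v i)
lemma4p1 G _ T _ ρ _ cyc isCycle =
    IsCycle-cong-rotor G cyc T ρ (flip G (pushCycle G cyc ρ)) (flip-pushCycle-rotor G cyc ρ) isCycle
  , λ v _ → flip-pushCycle-involutive G cyc ρ v
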